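{- Let $A,B$ be formulas of $\mathsf{CPL}$, $a$ a name with $a\notin\mathrm{FN}(A)$, and $q\in\mathbb Q$ with $0<q\le 1$. Then for every finite set of names $X$ with $a\notin X$ and $\mathrm{FN}(A)\cup\mathrm{FN}(B)\subseteq X\cup\{a\}$: $[\![A\wedge\mathbf C^q_aB]\!]_X=[\![\mathbf C^q_a(A\wedge B)]\!]_X$, $[\![A\vee\mathbf C^q_aB]\!]_X=[\![\mathbf C^q_a(A\vee B)]\!]_X$, $[\![A\wedge\mathbf D^q_aB]\!]_X=[\![\mathbf D^q_a(\neg A\vee B)]\!]_X$, and $[\![A\vee\mathbf D^q_aB]\!]_X=[\![\mathbf D^q_a(\neg A\wedge B)]\!]_X$.
   Context: $\mathsf{CPL}$: fix a countable set of names. Formulas: $A,B::=\mathbf{i}_a\mid \neg A\mid A\wedge B\mid A\vee B\mid \mathbf{C}^q_aA\mid \mathbf{D}^q_aA$, with $i\in\mathbb N$, $q\in\mathbb Q\cap[0,1]$; $a$ is bound in $\mathbf C^q_aA,\mathbf D^q_aA$; $\mathrm{FN}(A)$ is the set of free names; bound names are taken up to renaming. For finite $X$, $(2^\omega)^X$ is the set of maps $X\to\{0,1\}^{\mathbb N}$ with the product fair-coin measure $\mu$. For disjoint $X,Y$, $f\in(2^\omega)^X$, $\mathcal X\subseteq(2^\omega)^{X\cup Y}$: $\Pi_f(\mathcal X)=\{g\in(2^\omega)^Y\mid f+g\in\mathcal X\}$ ($f+g$ agrees with $f$ on $X$, $g$ on $Y$). For $X\supseteq\mathrm{FN}(A)$: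 $[\![\mathbf i_a]\!]_X=\{f\mid f(a)(i)=1\}$; $\neg,\wedge,\vee$ as complement, intersection, union in $(2^\omega)^X$; $[\![\mathbf C^q_aA]\!]_X=\{f\mid\mu(\Pi_f([\![A]\!]_{X\cup\{a\}}))\ge q\}$, $[\![\mathbf D^q_aA]\!]_X=\{f\mid\mu(\Pi_f([\![A]\!]_{X\cup\{a\}}))<q\}$ (with $a\notin X$). -}

module Defs where

open import Data.Bool using (Bool; true; false; not; _∧_; _∨_; if_then_else_)
open import Data.Nat using (ℕ; zero; suc; _⊔_; _^_)
open import Data.Nat.Properties using (m^n≢0)
open import Data.Integer using (+_)
open import Data.Rational using (ℚ; 0ℚ; 1ℚ; _≤_; _≤ᵇ_; _/_)
open import Data.Product using (Σ; _×_; _,_)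
open import Data.List using (List; []; _∷_; _++_; filter; length; map; concatMap)
open import Data.List.Membership.Propositional using (_∈_)
open import Data.List.Membership.DecPropositional Data.Nat._≟_ using (_∈?_)
open import Data.List.Relation.Unary.Any using (here; there)
open import Data.Vec using (Vec; []; _∷_; lookup)
open import Data.Fin using (Fin)
open import Data.Nat using (_<?_)
open import Relation.Nullary using (yes; no; ¬?)
open import Relation.Binary.PropositionalEquality using (_≡_; refl)

Name : Set
Name = ℕ

Q01 : Set
Q01 = Σ ℚ (λ q → (0ℚ ≤ q) × (q ≤ 1ℚ))

-- Syntax of CPL (named binders; bound names up to renaming is respected by the semantics).
data Formula : Set where
  atom : ℕ → Name → Formula
  ¬ᶠ_  : Formula → Formula
  _∧ᶠ_ : Formula → Formula → Formula
  _∨ᶠ_ : Formula → Formula → Formula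
  𝐂    : Q01 → Name → Formula → Formula
  𝐃    : Q01 → Name → Formula → Formula

FN : Formula → List Name
FN (atom i a) = a ∷ []
FN (¬ᶠ A) = FN A
FN (A ∧ᶠ B) = FN A ++ FN B
FN (A ∨ᶠ B) = FN A ++ FN B
FN (𝐂 q a A) = filter (λ x → ¬? (x Data.Nat.≟ a)) (FN A)
FN (𝐃 q a A) = filter (λ x → ¬? (x Data.Nat.≟ a)) (FN A)

bits : Formula → ℕ
bits (atom i a) = suc i
bits (¬ᶠ A) = bits A
bits (A ∧ᶠ B) = bits A ⊔ bits B
bits (A ∨ᶠ B) = bits A ⊔ bits B
bits (𝐂 q a A) = bits A
bits (𝐃 q a A) = bits A

Cantor : Set
Cantor = ℕ → Bool

Assign : List Name → Set
Assign X = (x : Name) → x ∈ X → Cantor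

extendA : ∀ {X} (a : Name) → Assign X → Cantor → Assign (a ∷ X)
extendA a f g .a (here refl) = g
extendA a f g x (there p) = f x p

allVecs : (k : ℕ) → List (Vec Bool k)
allVecs zero = [] ∷ []
allVecs (suc k) = concatMap (λ v → (false ∷ v) ∷ (true ∷ v) ∷ []) (allVecs k)

pad : ∀ {k} → Vec Bool k → Cantor
pad {k} v i with i <? k
... | yes i<k = lookup v (Data.Fin.fromℕ< i<k)
... | no _ = false

-- Product fair-coin measure of a subset S of 2^ω that depends only on the
-- first k bits: (number of length-k prefixes in S) / 2^k.
μ : (k : ℕ) → (Cantor → Bool) → ℚ
μ k S = (+ length (filter (λ v → S (pad v) Data.Bool.≟ true) (allVecs k))) / (2 ^ k)
  where instance _ = m^n≢0 2 k

Subset : List Name → Set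
Subset X = Assign X → Bool

⟦_⟧ : Formula → (X : List Name) → Subset X
⟦ atom i a ⟧ X f with a ∈? X
... | yes p = f a p i
... | no _ = false
⟦ ¬ᶠ A ⟧ X f = not (⟦ A ⟧ X f)
⟦ A ∧ᶠ B ⟧ X f = ⟦ A ⟧ X f ∧ ⟦ B ⟧ X f
⟦ A ∨ᶠ B ⟧ X f = ⟦ A ⟧ X f ∨ ⟦ B ⟧ X f
⟦ 𝐂 (q , _) a A ⟧ X f = q ≤ᵇ μ (bits A) (λ g → ⟦ A ⟧ (a ∷ X) (extendA a f g))
⟦ 𝐃 (q , _) a A ⟧ X f = not (q ≤ᵇ μ (bits A) (λ g → ⟦ A ⟧ (a ∷ X) (extendA a f g)))

_≐_ : ∀ {X} → Subset X → Subset X → Set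
S ≐ T = ∀ f → S f ≡ T f
infix 4 _≐_

{-# OPTIONS --safe #-}
module Submission where

-- Fix f ∈ (2^ω)^X. As a ∉ FN A, the formula A takes the constant value α = ⟦ A ⟧ X f on the
-- whole fibre over f, so the fibre of A ∧ B is that of B when α holds and empty otherwise, and
-- the fibre of A ∨ B is everything when α holds and that of B otherwise. Since 0 < q ≤ 1 the
-- empty set never reaches the threshold q and the whole space always does; this settles the
-- 𝐂-equations by cases on α, and the 𝐃-equations follow by De Morgan. The only technical point
-- is that μ counts prefixes up to the depth bits (A ∧ᶠ B) rather than bits B: the proportion
-- of prefixes in a set that depends only on the first m bits is the same at every depth ≥ m.

open import Defs
open import Data.Bool using (Bool; true; false; not; _∧_; _∨_; _≟_)
open import Data.Nat as ℕ using (ℕ; zero; suc; _+_; _*_; _^_; _⊔_; _<?_; _≤′_; ≤′-refl; ≤′-step; s≤s; z≤n; NonZero)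
open import Data.Nat.Properties
  using ( ≤-refl; <-≤-trans; <-irrelevant; ≤⇒≤′; ≤′⇒≤; m≤m⊔n; m≤n⊔m
        ; +-suc; +-identityʳ; *-comm; *-assoc; *-distribˡ-+; m^n≢0)
open import Data.Integer using (+_)
open import Data.Integer.Properties using (pos-*)
open import Data.Rational using (0ℚ; 1ℚ; _<_; _≤_; _/_; _≤ᵇ_)
open import Data.Rational.Properties as ℚ using (fromℚᵘ-cong; ≤ᵇ⇒≤; ≤⇒≤ᵇ)
open import Data.Rational.Unnormalised using (mkℚᵘ; *≡*)
open import Data.Product using (proj₁; _×_; _,_)
open import Data.List using (List; []; _∷_; _++_; length; filter; concatMap)
open import Data.List.Properties using (filter-≐)
open import Data.List.Membership.Propositional using (_∈_; _∉_)
open import Data.List.Membership.Propositional.Properties using (∈-filter⁺; ∈-++⁺ˡ; ∈-++⁺ʳ)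
open import Data.List.Membership.DecPropositional ℕ._≟_ using (_∈?_)
open import Data.List.Relation.Binary.Subset.Propositional using (_⊆_)
open import Data.List.Relation.Unary.Any using (here)
open import Data.Vec using (Vec; _∷_; lookup)
open import Data.Fin using (fromℕ<)
open import Data.Empty using (⊥-elim-irr)
open import Function using (_∘_; case_of_)
open import Relation.Nullary using (yes; no; ¬?; T?; contradiction)
open import Relation.Nullary.Decidable using (dec-true; dec-false)
open import Relation.Binary.PropositionalEquality

cross-multiply⇒/-≡ : ∀ m n c d .{{_ : NonZero c}} .{{_ : NonZero d}} → m * d ≡ n * c → (+ m) / c ≡ (+ n) / d
cross-multiply⇒/-≡ m n zero    _       {{c≢0}} _ = ⊥-elim-irr (NonZero.nonZero c≢0)
cross-multiply⇒/-≡ m n (suc _) zero {{_}} {{d≢0}} _ = ⊥-elim-irr (NonZero.nonZero d≢0)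
cross-multiply⇒/-≡ m n (suc c) (suc d) md≡nc = fromℚᵘ-cong {mkℚᵘ (+ m) c} {mkℚᵘ (+ n) d}
  (*≡* (trans (sym (pos-* m (suc d))) (trans (cong +_ md≡nc) (pos-* n (suc c)))))

count : ∀ {A : Set} → (A → Bool) → List A → ℕ
count p xs = length (filter (λ x → p x ≟ true) xs)

count-cong : ∀ {A : Set} {p p′ : A → Bool} → (∀ x → p x ≡ p′ x) → ∀ xs → count p xs ≡ count p′ xs
count-cong p≗p′ xs =
  cong length (filter-≐ _ _ ((λ {x} → trans (sym (p≗p′ x))) , λ {x} → trans (p≗p′ x)) xs)

count-concatMap-pair : ∀ {A B : Set} (p : B → Bool) (f g : A → B) xs →
  count p (concatMap (λ x → f x ∷ g x ∷ []) xs) ≡ count (p ∘ f) xs + count (p ∘ g) xs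
count-concatMap-pair p f g [] = refl
count-concatMap-pair p f g (x ∷ xs) with p (f x)
... | true with p (g x)
...   | true  = cong suc (trans (cong suc (count-concatMap-pair p f g xs)) (sym (+-suc _ _)))
...   | false = cong suc (count-concatMap-pair p f g xs)
count-concatMap-pair p f g (x ∷ xs) | false with p (g x)
...   | true  = trans (cong suc (count-concatMap-pair p f g xs)) (sym (+-suc _ _))
...   | false = count-concatMap-pair p f g xs

cons : Bool → Cantor → Cantor
cons b g zero    = b
cons b g (suc i) = g i

pad-∷ : ∀ {k} b (v : Vec Bool k) i → pad (b ∷ v) i ≡ cons b (pad v) i
pad-∷ b v zero = refl
pad-∷ {k} b v (suc i) with suc i <? suc k | i <? k
... | yes (s≤s i<k) | yes i<k′ = cong (λ i<k → lookup v (fromℕ< i<k)) (<-irrelevant i<k i<k′)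
... | yes (s≤s i<k) | no i≮k   = contradiction i<k i≮k
... | no 1+i≮1+k    | yes i<k  = contradiction (s≤s i<k) 1+i≮1+k
... | no _          | no _     = refl

EqualBelow : ℕ → Cantor → Cantor → Set
EqualBelow k g h = ∀ i → i ℕ.< k → g i ≡ h i

DependsOn : ℕ → (Cantor → Bool) → Set
DependsOn k S = ∀ {g h} → EqualBelow k g h → S g ≡ S h

DependsOn-mono : ∀ {m n S} → m ℕ.≤ n → DependsOn m S → DependsOn n S
DependsOn-mono m≤n dep g≈h = dep (λ i i<m → g≈h i (<-≤-trans i<m m≤n))

DependsOn-cons : ∀ {k S} b → DependsOn (suc k) S → DependsOn k (S ∘ cons b)
DependsOn-cons b dep g≈h = dep λ { zero _ → refl ; (suc i) (s≤s i<k) → g≈h i i<k }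

hits : ℕ → (Cantor → Bool) → ℕ
hits k S = count (S ∘ pad) (allVecs k)

hits-cong : ∀ k S T → (∀ g → S g ≡ T g) → hits k S ≡ hits k T
hits-cong k S T S≗T = count-cong (S≗T ∘ pad) (allVecs k)

-- Any DependsOn hypothesis makes S extensional, which is all that is used here.
hits-split : ∀ k {m S} → DependsOn m S →
  hits (suc k) S ≡ hits k (S ∘ cons false) + hits k (S ∘ cons true)
hits-split k {S = S} dep = trans (count-concatMap-pair (S ∘ pad) (false ∷_) (true ∷_) (allVecs k))
  (cong₂ _+_ (count-cong (λ v → dep (λ i _ → pad-∷ false v i)) (allVecs k))
             (count-cong (λ v → dep (λ i _ → pad-∷ true v i)) (allVecs k)))

hits-suc : ∀ k {S} → DependsOn k S → hits (suc k) S ≡ 2 * hits k S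
hits-suc zero {S} dep = begin
  hits 1 S                                          ≡⟨ hits-split 0 dep ⟩
  hits 0 (S ∘ cons false) + hits 0 (S ∘ cons true)  ≡⟨ cong₂ _+_ (hits-cong 0 (S ∘ cons false) S λ _ → dep λ _ ())
                                                                   (hits-cong 0 (S ∘ cons true) S λ _ → dep λ _ ()) ⟩
  hits 0 S + hits 0 S                               ≡⟨ cong (_+_ (hits 0 S)) (+-identityʳ _) ⟨
  2 * hits 0 S                                      ∎
  where open ≡-Reasoning
hits-suc (suc k) {S} dep = begin
  hits (2 + k) S                                                ≡⟨ hits-split (suc k) dep ⟩
  hits (suc k) (S ∘ cons false) + hits (suc k) (S ∘ cons true)  ≡⟨ cong₂ _+_ (hits-suc k (DependsOn-cons false dep))
                                                                             (hits-suc k (DependsOn-cons true dep)) ⟩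
  2 * hits k (S ∘ cons false) + 2 * hits k (S ∘ cons true)      ≡⟨ *-distribˡ-+ 2 (hits k (S ∘ cons false)) _ ⟨
  2 * (hits k (S ∘ cons false) + hits k (S ∘ cons true))        ≡⟨ cong (2 *_) (hits-split k dep) ⟨
  2 * hits (suc k) S                                            ∎
  where open ≡-Reasoning

μ-≡ : ∀ k k′ S T → hits k S * 2 ^ k′ ≡ hits k′ T * 2 ^ k → μ k S ≡ μ k′ T
μ-≡ k k′ S T = cross-multiply⇒/-≡ (hits k S) (hits k′ T) (2 ^ k) (2 ^ k′) {{m^n≢0 2 k}} {{m^n≢0 2 k′}}

μ-cong : ∀ k {S T} → (∀ g → S g ≡ T g) → μ k S ≡ μ k T
μ-cong k {S} {T} S≗T = μ-≡ k k S T (cong (_* 2 ^ k) (hits-cong k S T S≗T))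

μ-suc : ∀ k {S} → DependsOn k S → μ (suc k) S ≡ μ k S
μ-suc k {S} dep = μ-≡ (suc k) k S S (begin
  hits (suc k) S * 2 ^ k  ≡⟨ cong (_* 2 ^ k) (hits-suc k dep) ⟩
  2 * hits k S * 2 ^ k    ≡⟨ cong (_* 2 ^ k) (*-comm 2 (hits k S)) ⟩
  hits k S * 2 * 2 ^ k    ≡⟨ *-assoc (hits k S) 2 (2 ^ k) ⟩
  hits k S * 2 ^ suc k    ∎)
  where open ≡-Reasoning

μ-stable : ∀ {m n S} → DependsOn m S → m ℕ.≤ n → μ n S ≡ μ m S
μ-stable {m} {S = S} dep m≤n = go (≤⇒≤′ m≤n)
  where
  go : ∀ {n} → m ≤′ n → μ n S ≡ μ m S
  go ≤′-refl            = refl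
  go (≤′-step {n} m≤′n) = trans (μ-suc n (DependsOn-mono (≤′⇒≤ m≤′n) dep)) (go m≤′n)

μ-const : ∀ k b → μ k (λ _ → b) ≡ μ 0 (λ _ → b)
μ-const k b = μ-stable {0} {k} {λ _ → b} (λ _ → refl) z≤n

≤ᵇ-μ-∧ : ∀ {q} → 0ℚ < q → ∀ k b S → (q ≤ᵇ μ k (λ g → b ∧ S g)) ≡ b ∧ (q ≤ᵇ μ k S)
≤ᵇ-μ-∧ 0<q k true S = refl
≤ᵇ-μ-∧ {q} 0<q k false S = begin
  q ≤ᵇ μ k (λ _ → false)  ≡⟨ cong (q ≤ᵇ_) (μ-const k false) ⟩
  q ≤ᵇ 0ℚ                 ≡⟨ dec-false (T? (q ≤ᵇ 0ℚ)) (λ q≤0 → ℚ.<-irrefl refl (ℚ.<-≤-trans 0<q (≤ᵇ⇒≤ q≤0))) ⟩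
  false                   ∎
  where open ≡-Reasoning

≤ᵇ-μ-∨ : ∀ {q} → q ≤ 1ℚ → ∀ k b S → (q ≤ᵇ μ k (λ g → b ∨ S g)) ≡ b ∨ (q ≤ᵇ μ k S)
≤ᵇ-μ-∨ {q} q≤1 k true S = begin
  q ≤ᵇ μ k (λ _ → true)  ≡⟨ cong (q ≤ᵇ_) (μ-const k true) ⟩
  q ≤ᵇ 1ℚ                ≡⟨ dec-true (T? (q ≤ᵇ 1ℚ)) (≤⇒≤ᵇ q≤1) ⟩
  true                   ∎
  where open ≡-Reasoning
≤ᵇ-μ-∨ q≤1 k false S = refl

value : ∀ {X} → Assign X → Name → Cantor
value {X} f x with x ∈? X
... | yes x∈X = f x x∈X
... | no _    = λ _ → false

⟦atom⟧≡value : ∀ i b X (f : Assign X) → ⟦ atom i b ⟧ X f ≡ value f b i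
⟦atom⟧≡value i b X f with b ∈? X
... | yes _ = refl
... | no _  = refl

value-extendA-here : ∀ {X} b (f : Assign X) g i → value (extendA b f g) b i ≡ g i
value-extendA-here b f g i with b ℕ.≟ b
... | yes refl = refl
... | no b≢b   = contradiction refl b≢b

value-extendA-there : ∀ {X} b (f : Assign X) g {x} → x ≢ b → ∀ i → value (extendA b f g) x i ≡ value f x i
value-extendA-there {X} b f g {x} x≢b i with x ℕ.≟ b
... | yes x≡b = contradiction x≡b x≢b
... | no _ with x ∈? X
...   | yes _ = refl
...   | no _  = refl

record Agree {X Y} (N : List Name) (k : ℕ) (f : Assign X) (f′ : Assign Y) : Set where
  constructor agree
  field at : ∀ x → x ∈ N → EqualBelow k (value f x) (value f′ x)

open Agree

Agree-weaken : ∀ {X Y N N′ k k′} {f : Assign X} {f′ : Assign Y} →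
  N′ ⊆ N → k′ ℕ.≤ k → Agree N k f f′ → Agree N′ k′ f f′
Agree-weaken N′⊆N k′≤k f≈f′ =
  agree λ x x∈N′ i i<k′ → at f≈f′ x (N′⊆N x∈N′) i (<-≤-trans i<k′ k′≤k)

-- case, not with: abstracting x ≟ b would also rewrite it inside value (extendA b f g) x.
Agree-extendA : ∀ {X Y N k} {f : Assign X} {f′ : Assign Y} b {g g′} → EqualBelow k g g′ →
  Agree (filter (λ x → ¬? (x ℕ.≟ b)) N) k f f′ → Agree N k (extendA b f g) (extendA b f′ g′)
Agree-extendA {f = f} {f′} b {g} {g′} g≈g′ f≈f′ = agree λ x x∈N i i<k → case x ℕ.≟ b of λ where
  (yes refl) → trans (value-extendA-here b f g i) (trans (g≈g′ i i<k) (sym (value-extendA-here b f′ g′ i)))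
  (no x≢b)   → trans (value-extendA-there b f g x≢b i)
    (trans (at f≈f′ x (∈-filter⁺ (λ x → ¬? (x ℕ.≟ b)) x∈N x≢b) i i<k)
           (sym (value-extendA-there b f′ g′ x≢b i)))

⟦⟧-coincidence : ∀ A {X Y} {f : Assign X} {f′ : Assign Y} →
  Agree (FN A) (bits A) f f′ → ⟦ A ⟧ X f ≡ ⟦ A ⟧ Y f′
⟦⟧-coincidence (atom i b) {X} {Y} {f} {f′} f≈f′ =
  trans (⟦atom⟧≡value i b X f) (trans (at f≈f′ b (here refl) i ≤-refl) (sym (⟦atom⟧≡value i b Y f′)))
⟦⟧-coincidence (¬ᶠ A) f≈f′ = cong not (⟦⟧-coincidence A f≈f′)
⟦⟧-coincidence (A ∧ᶠ B) f≈f′ = cong₂ _∧_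
  (⟦⟧-coincidence A (Agree-weaken ∈-++⁺ˡ (m≤m⊔n (bits A) (bits B)) f≈f′))
  (⟦⟧-coincidence B (Agree-weaken (∈-++⁺ʳ (FN A)) (m≤n⊔m (bits A) (bits B)) f≈f′))
⟦⟧-coincidence (A ∨ᶠ B) f≈f′ = cong₂ _∨_
  (⟦⟧-coincidence A (Agree-weaken ∈-++⁺ˡ (m≤m⊔n (bits A) (bits B)) f≈f′))
  (⟦⟧-coincidence B (Agree-weaken (∈-++⁺ʳ (FN A)) (m≤n⊔m (bits A) (bits B)) f≈f′))
⟦⟧-coincidence (𝐂 (q , _) b A) f≈f′ =
  cong (q ≤ᵇ_) (μ-cong (bits A) λ g → ⟦⟧-coincidence A (Agree-extendA b {g} {g} (λ _ _ → refl) f≈f′))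
⟦⟧-coincidence (𝐃 (q , _) b A) f≈f′ =
  cong (not ∘ (q ≤ᵇ_)) (μ-cong (bits A) λ g → ⟦⟧-coincidence A (Agree-extendA b {g} {g} (λ _ _ → refl) f≈f′))

⟦⟧-extendA-fresh : ∀ A {X} a (f : Assign X) g → a ∉ FN A → ⟦ A ⟧ (a ∷ X) (extendA a f g) ≡ ⟦ A ⟧ X f
⟦⟧-extendA-fresh A a f g a∉A =
  ⟦⟧-coincidence A (agree λ x x∈A i _ → value-extendA-there a f g (λ { refl → a∉A x∈A }) i)

⟦⟧-extendA-dependsOn : ∀ A {X} a (f : Assign X) → DependsOn (bits A) (λ g → ⟦ A ⟧ (a ∷ X) (extendA a f g))
⟦⟧-extendA-dependsOn A a f g≈h = ⟦⟧-coincidence A (Agree-extendA a g≈h (agree λ _ _ _ _ → refl))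

∧-not≡not-not-∨ : ∀ x y → x ∧ not y ≡ not (not x ∨ y)
∧-not≡not-not-∨ true  y = refl
∧-not≡not-not-∨ false y = refl

∨-not≡not-not-∧ : ∀ x y → x ∨ not y ≡ not (not x ∧ y)
∨-not≡not-not-∧ true  y = refl
∨-not≡not-not-∧ false y = refl

lemma6 : (A B : Formula) (a : Name) (q : Q01) → a ∉ FN A → 0ℚ < proj₁ q →
    (X : List Name) → a ∉ X → FN A ++ FN B ⊆ a ∷ X →
    (⟦ A ∧ᶠ 𝐂 q a B ⟧ X ≐ ⟦ 𝐂 q a (A ∧ᶠ B) ⟧ X)
    × (⟦ A ∨ᶠ 𝐂 q a B ⟧ X ≐ ⟦ 𝐂 q a (A ∨ᶠ B) ⟧ X)
    × (⟦ A ∧ᶠ 𝐃 q a B ⟧ X ≐ ⟦ 𝐃 q a ((¬ᶠ A) ∨ᶠ B) ⟧ X)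
    × (⟦ A ∨ᶠ 𝐃 q a B ⟧ X ≐ ⟦ 𝐃 q a ((¬ᶠ A) ∧ᶠ B) ⟧ X)
lemma6 A B a (q , _ , q≤1) a∉A 0<q X _ _ =
    (λ f → sym (pull _∧_ (≤ᵇ-μ-∧ 0<q K) f))
  , (λ f → sym (pull _∨_ (≤ᵇ-μ-∨ q≤1 K) f))
  , (λ f → trans (∧-not≡not-not-∨ (α f) (θ f))
                 (cong not (sym (pull (λ x y → not x ∨ y) (≤ᵇ-μ-∨ q≤1 K ∘ not) f))))
  , (λ f → trans (∨-not≡not-not-∧ (α f) (θ f))
                 (cong not (sym (pull (λ x y → not x ∧ y) (≤ᵇ-μ-∧ 0<q K ∘ not) f))))
  where
  K = bits A ⊔ bits B
  α = ⟦ A ⟧ X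

  fibreB : Assign X → Cantor → Bool
  fibreB f g = ⟦ B ⟧ (a ∷ X) (extendA a f g)

  θ : Assign X → Bool
  θ f = q ≤ᵇ μ (bits B) (fibreB f)

  pull : ∀ (_⊙_ : Bool → Bool → Bool) → (∀ b S → (q ≤ᵇ μ K (λ g → b ⊙ S g)) ≡ b ⊙ (q ≤ᵇ μ K S)) →
    ∀ f → (q ≤ᵇ μ K (λ g → ⟦ A ⟧ (a ∷ X) (extendA a f g) ⊙ fibreB f g)) ≡ α f ⊙ θ f
  pull _⊙_ ≤ᵇ-μ-⊙ f = begin
    q ≤ᵇ μ K (λ g → ⟦ A ⟧ (a ∷ X) (extendA a f g) ⊙ fibreB f g)
      ≡⟨ cong (q ≤ᵇ_) (μ-cong K λ g → cong (_⊙ fibreB f g) (⟦⟧-extendA-fresh A a f g a∉A)) ⟩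
    q ≤ᵇ μ K (λ g → α f ⊙ fibreB f g)
      ≡⟨ ≤ᵇ-μ-⊙ (α f) (fibreB f) ⟩
    α f ⊙ (q ≤ᵇ μ K (fibreB f))
      ≡⟨ cong (λ m → α f ⊙ (q ≤ᵇ m)) (μ-stable (⟦⟧-extendA-dependsOn B a f) (m≤n⊔m (bits A) (bits B))) ⟩
    α f ⊙ θ f
      ∎
    where open ≡-Reasoning
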